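{- Let $T(n)=\sum_{k=0}^{n}\left[\binom{n+5k}{2k}\binom{n}{k}\bmod 2\right]$ for $n\ge 0$. Let $(S(n))_{n\ge0}$ be defined by $S(0)=1$, $S(1)=S(2)=2$, $S(3)=3$, and $S(n)=S(n-1)+S(n-2)-S(n-3)+S(n-4)$ for $n\ge 4$. Then $T$ is the run length transform of $S$.
   Context: For integers $a$ and $b\ge0$, $\binom{a}{b}=0$ whenever $a<b$. $[x \bmod 2]$ denotes the residue in $\{0,1\}$. The run length transform of a sequence $(S(n))_{n\ge0}$ is $T(n)=\prod_{i\in\mathcal{L}(n)}S(i)$, where $\mathcal{L}(n)$ is the multiset of lengths of all maximal runs of $1$'s in the binary representation of $n$ (so $T(0)=1$). -}

module Defs where

open import Data.Nat using (ℕ; zero; suc; _+_; _*_; _∸_; _%_; _/_)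
open import Data.Nat.Combinatorics using (_C_)
open import Data.List using (List; []; _∷_; map; foldr; upTo)
open import Data.Nat.ListAction using (sum)
open import Data.Integer as ℤ using (ℤ; +_)

-- Binary digits of n, least significant first (no leading zeros; bits 0 = []).
-- The fuel argument is ≥ the number of digits (we use fuel = n).
bitsFuel : ℕ → ℕ → List ℕ
bitsFuel zero    n = []
bitsFuel (suc f) zero = []
bitsFuel (suc f) n@(suc _) = (n % 2) ∷ bitsFuel f (n / 2)

bits : ℕ → List ℕ
bits n = bitsFuel n n

-- Lengths of maximal runs of 1's in a digit list.  'cur' is the length of
-- the run currently being read.
runsAux : ℕ → List ℕ → List ℕ
runsAux zero      []       = []
runsAux cur@(suc _) []     = cur ∷ []
runsAux cur (1 ∷ ds)       = runsAux (suc cur) ds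
runsAux zero (_ ∷ ds)      = runsAux zero ds
runsAux cur@(suc _) (_ ∷ ds) = cur ∷ runsAux zero ds

runLengths : ℕ → List ℕ
runLengths n = runsAux zero (bits n)

runLengthTransform : (ℕ → ℤ) → ℕ → ℤ
runLengthTransform S n = foldr ℤ._*_ (+ 1) (map S (runLengths n))

-- S(0)=1, S(1)=S(2)=2, S(3)=3, S(n)=S(n-1)+S(n-2)-S(n-3)+S(n-4) (n ≥ 4),
-- computed in ℤ so the subtraction is genuine.
S : ℕ → ℤ
S 0 = + 1
S 1 = + 2
S 2 = + 2
S 3 = + 3
S (suc (suc (suc (suc n)))) =
  S (suc (suc (suc n))) ℤ.+ S (suc (suc n)) ℤ.- S (suc n) ℤ.+ S n

T : ℕ → ℕ
T n = sum (map (λ k → (((n + 5 * k) C (2 * k)) * (n C k)) % 2) (upTo (suc n)))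

{-# OPTIONS --safe #-}
module Submission where

-- By Lucas' theorem mod 2, the summand [C(n + 5k + c, 2k + d) C(n, k) mod 2] factors through the
-- lowest binary digits r of n and s of k: it is a 0/1 coefficient depending on (c, d, r, s) times
-- the same summand for ⌊n/2⌋, ⌊k/2⌋ and the new carries ((r + 5s + c)/2, s). Summing over k, the
-- vector of these totals for the four reachable carry pairs is multiplied by a matrix M₀ or M₁ for
-- each binary digit of n. M₀ has rank one, M₀ v = v₀₀ · 𝟙 with 𝟙 the vector at n = 0, so a 0 digit
-- cuts the product and a run of j ones contributes e₀₀ M₁ʲ 𝟙 = S j; this sequence obeys the
-- recurrence of S because x⁴ − x³ − x² + x − 1 is the characteristic polynomial of M₁.

open import Defs
open import Data.Nat using (ℕ)
open import Data.Integer using (+_)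
open import Relation.Binary.PropositionalEquality using (_≡_)

open import Data.Nat using (zero; suc; _+_; _*_; _≤_; _<_; z≤n; s≤s; _%_; _/_)
open import Data.Nat.Properties
  using (+-identityʳ; +-assoc; +-suc; *-suc; *-comm; *-zeroʳ; *-mono-≤; +-monoˡ-≤;
         ≤-refl; ≤-trans; ≤-pred; ≤-reflexive)
open import Data.Nat.DivMod
  using (m≡m%n+[m/n]*n; m%n<n; m/n<m; m%n%n≡m%n; m*n%n≡0; %-distribˡ-+; %-distribˡ-*)
open import Data.Nat.Combinatorics using (_C_; nCk+nC[k+1]≡[n+1]C[k+1]; k>n⇒nCk≡0)
open import Data.Nat.ListAction using (sum)
open import Data.Nat.Tactic.RingSolver using (solve-∀)
open import Data.List using (List; []; _∷_; map; foldr; upTo; applyUpTo)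
open import Data.List.Properties using (map-upTo)
open import Data.List.Relation.Unary.All using (All; []; _∷_)
import Data.Integer as ℤ
import Data.Integer.Properties as ℤ
import Data.Integer.Tactic.RingSolver as ℤ-Solver
open import Function using (_∘_)
open import Relation.Binary.PropositionalEquality
  using (refl; sym; trans; cong; cong₂; subst; subst₂; _≗_; module ≡-Reasoning)

infix 4 _≡₂_

-- A record rather than a synonym for a % 2 ≡ b % 2, so that implicit arguments can be
-- inferred through it (_%_ and _C_ are not injective).
record _≡₂_ (a b : ℕ) : Set where
  constructor mod₂
  field mod₂-≡ : a % 2 ≡ b % 2

open _≡₂_

≡⇒≡₂ : ∀ {a b} → a ≡ b → a ≡₂ b
≡⇒≡₂ a≡b = mod₂ (cong (_% 2) a≡b)

≡₂-trans : ∀ {a b c} → a ≡₂ b → b ≡₂ c → a ≡₂ c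
≡₂-trans (mod₂ p) (mod₂ q) = mod₂ (trans p q)

+-cong-≡₂ : ∀ {a b c d} → a ≡₂ c → b ≡₂ d → a + b ≡₂ c + d
+-cong-≡₂ {a} {b} {c} {d} (mod₂ a≡c) (mod₂ b≡d) = mod₂ (begin
  (a + b) % 2             ≡⟨ %-distribˡ-+ a b 2 ⟩
  (a % 2 + b % 2) % 2     ≡⟨ cong₂ (λ x y → (x + y) % 2) a≡c b≡d ⟩
  (c % 2 + d % 2) % 2     ≡⟨ %-distribˡ-+ c d 2 ⟨
  (c + d) % 2             ∎)
  where open ≡-Reasoning

*-cong-≡₂ : ∀ {a b c d} → a ≡₂ c → b ≡₂ d → a * b ≡₂ c * d
*-cong-≡₂ {a} {b} {c} {d} (mod₂ a≡c) (mod₂ b≡d) = mod₂ (begin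
  (a * b) % 2             ≡⟨ %-distribˡ-* a b 2 ⟩
  (a % 2 * (b % 2)) % 2   ≡⟨ cong₂ (λ x y → (x * y) % 2) a≡c b≡d ⟩
  (c % 2 * (d % 2)) % 2   ≡⟨ %-distribˡ-* c d 2 ⟨
  (c * d) % 2             ∎)
  where open ≡-Reasoning

≡₂-%2 : ∀ a → a ≡₂ a % 2
≡₂-%2 a = mod₂ (sym (m%n%n≡m%n a 2))

x+x≡₂0 : ∀ x → x + x ≡₂ 0
x+x≡₂0 x = mod₂ (trans (cong (_% 2) (x+x≡x*2 x)) (m*n%n≡0 x 2))
  where
  x+x≡x*2 : ∀ x → x + x ≡ x * 2
  x+x≡x*2 = solve-∀

pascal-≡₂ : ∀ n k {x y} → n C k ≡₂ x → n C suc k ≡₂ y → suc n C suc k ≡₂ x + y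
pascal-≡₂ n k p q =
  ≡₂-trans (≡⇒≡₂ (sym (nCk+nC[k+1]≡[n+1]C[k+1] n k))) (+-cong-≡₂ p q)

private
  double : ℕ → ℕ
  double zero    = zero
  double (suc n) = suc (suc (double n))

  double≡2* : ∀ n → double n ≡ 2 * n
  double≡2* zero    = refl
  double≡2* (suc n) = trans (cong (λ m → suc (suc m)) (double≡2* n)) (sym (*-suc 2 n))

mutual
  private
    C-even-even : ∀ a b → double a C double b ≡₂ a C b
    C-even-even a       zero    = mod₂ refl
    C-even-even zero    (suc b) = mod₂ refl
    C-even-even (suc a) (suc b) =
      ≡₂-trans (pascal-≡₂ (suc (double a)) (suc (double b))
                          (C-odd-odd a b) (C-odd-even a (suc b)))
               (≡⇒≡₂ (nCk+nC[k+1]≡[n+1]C[k+1] a b))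

    C-even-odd : ∀ a b → double a C suc (double b) ≡₂ 0
    C-even-odd zero    b = mod₂ refl
    C-even-odd (suc a) b =
      ≡₂-trans (pascal-≡₂ (suc (double a)) (double b) (C-odd-even a b) (C-odd-odd a b))
               (x+x≡₂0 (a C b))

    C-odd-even : ∀ a b → suc (double a) C double b ≡₂ a C b
    C-odd-even a zero    = mod₂ refl
    C-odd-even a (suc b) =
      pascal-≡₂ (double a) (suc (double b)) (C-even-odd a b) (C-even-even a (suc b))

    C-odd-odd : ∀ a b → suc (double a) C suc (double b) ≡₂ a C b
    C-odd-odd a b =
      ≡₂-trans (pascal-≡₂ (double a) (double b) (C-even-even a b) (C-even-odd a b))
               (≡⇒≡₂ (+-identityʳ (a C b)))

lucas₂ : ∀ {x y} a b → x ≤ 1 → y ≤ 1 → (x + 2 * a) C (y + 2 * b) ≡₂ (x C y) * (a C b)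
lucas₂ {x} {y} a b x≤1 y≤1 =
  subst₂ (λ u v → (x + u) C (y + v) ≡₂ (x C y) * (a C b))
         (double≡2* a) (double≡2* b) (lucas-double x≤1 y≤1)
  where
  times-one : ∀ {n} → n ≡₂ a C b → n ≡₂ 1 * (a C b)
  times-one p = ≡₂-trans p (≡⇒≡₂ (sym (+-identityʳ (a C b))))

  lucas-double : ∀ {x y} → x ≤ 1 → y ≤ 1 →
                 (x + double a) C (y + double b) ≡₂ (x C y) * (a C b)
  lucas-double z≤n       z≤n       = times-one (C-even-even a b)
  lucas-double z≤n       (s≤s z≤n) = C-even-odd a b
  lucas-double (s≤s z≤n) z≤n       = times-one (C-odd-even a b)
  lucas-double (s≤s z≤n) (s≤s z≤n) = times-one (C-odd-odd a b)

∑< : ℕ → (ℕ → ℕ) → ℕ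
∑< N f = sum (applyUpTo f N)

∑<-cong : ∀ N {f g} → f ≗ g → ∑< N f ≡ ∑< N g
∑<-cong zero    f≗g = refl
∑<-cong (suc N) f≗g = cong₂ _+_ (f≗g 0) (∑<-cong N (λ k → f≗g (suc k)))

∑<-zero : ∀ N {f} → (∀ k → f k ≡ 0) → ∑< N f ≡ 0
∑<-zero zero    f≡0 = refl
∑<-zero (suc N) f≡0 = cong₂ _+_ (f≡0 0) (∑<-zero N (λ k → f≡0 (suc k)))

∑<-pad : ∀ {f} L N → (∀ k → L ≤ k → f k ≡ 0) → L ≤ N → ∑< N f ≡ ∑< L f
∑<-pad zero    N       f≡0 _         = ∑<-zero N (λ k → f≡0 k z≤n)
∑<-pad {f} (suc L) (suc N) f≡0 (s≤s L≤N) =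
  cong (_+_ (f 0)) (∑<-pad L N (λ k L≤k → f≡0 (suc k) (s≤s L≤k)) L≤N)

∑<-pairs : ∀ N f → ∑< (2 * N) f ≡ ∑< N (λ k → f (2 * k) + f (1 + 2 * k))
∑<-pairs zero    f = refl
∑<-pairs (suc N) f = begin
  ∑< (2 * suc N) f
    ≡⟨ cong (λ L → ∑< L f) (*-suc 2 N) ⟩
  f 0 + (f 1 + ∑< (2 * N) (λ k → f (2 + k)))
    ≡⟨ +-assoc (f 0) (f 1) _ ⟨
  f 0 + f 1 + ∑< (2 * N) (λ k → f (2 + k))
    ≡⟨ cong (_+_ (f 0 + f 1)) (∑<-pairs N (λ k → f (2 + k))) ⟩
  f 0 + f 1 + ∑< N (λ k → f (2 + 2 * k) + f (3 + 2 * k))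
    ≡⟨ cong (_+_ (f 0 + f 1)) (∑<-cong N λ k → cong (λ i → f i + f (1 + i)) (sym (*-suc 2 k))) ⟩
  ∑< (suc N) (λ k → f (2 * k) + f (1 + 2 * k)) ∎
  where open ≡-Reasoning

∑<-linear : ∀ N a b f g → ∑< N (λ k → a * f k + b * g k) ≡ a * ∑< N f + b * ∑< N g
∑<-linear zero    a b f g = sym (cong₂ _+_ (*-zeroʳ a) (*-zeroʳ b))
∑<-linear (suc N) a b f g =
  trans (cong (_+_ (a * f 0 + b * g 0)) (∑<-linear N a b (f ∘ suc) (g ∘ suc)))
        (interchange a b (f 0) (g 0) (∑< N (f ∘ suc)) (∑< N (g ∘ suc)))
  where
  interchange : ∀ a b x y X Y → a * x + b * y + (a * X + b * Y) ≡ a * (x + X) + b * (y + Y)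
  interchange = solve-∀

-- The summand of T n, shifted by carries c and d coming from lower binary digits.
term : ℕ → ℕ → ℕ → ℕ → ℕ
term c d n k = (((n + 5 * k + c) C (2 * k + d)) * (n C k)) % 2

total : ℕ → ℕ → ℕ → ℕ
total c d n = ∑< (suc n) (term c d n)

T≡total : ∀ n → T n ≡ total 0 0 n
T≡total n = begin
  sum (map summand (upTo (suc n))) ≡⟨ cong sum (map-upTo summand (suc n)) ⟩
  ∑< (suc n) summand               ≡⟨ ∑<-cong (suc n) add-zero-carries ⟩
  total 0 0 n                      ∎
  where
  open ≡-Reasoning
  summand : ℕ → ℕ
  summand k = (((n + 5 * k) C (2 * k)) * (n C k)) % 2
  add-zero-carries : summand ≗ term 0 0 n
  add-zero-carries k = cong₂ (λ u v → ((u C v) * (n C k)) % 2)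
                             (sym (+-identityʳ (n + 5 * k))) (sym (+-identityʳ (2 * k)))

term-vanish : ∀ c d n k → n < k → term c d n k ≡ 0
term-vanish c d n k n<k = begin
  (top * (n C k)) % 2 ≡⟨ cong (λ b → (top * b) % 2) (k>n⇒nCk≡0 n<k) ⟩
  (top * 0) % 2       ≡⟨ cong (_% 2) (*-zeroʳ top) ⟩
  0                   ∎
  where
  open ≡-Reasoning
  top = (n + 5 * k + c) C (2 * k + d)

C≤1 : ∀ {x y} → x ≤ 1 → y ≤ 1 → x C y ≤ 1
C≤1 z≤n       z≤n       = s≤s z≤n
C≤1 z≤n       (s≤s z≤n) = z≤n
C≤1 (s≤s z≤n) z≤n       = s≤s z≤n
C≤1 (s≤s z≤n) (s≤s z≤n) = s≤s z≤n

bit*-%2 : ∀ {a} b → a ≤ 1 → (a * (b % 2)) % 2 ≡ a * (b % 2)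
bit*-%2 b z≤n       = refl
bit*-%2 b (s≤s z≤n) = begin
  (b % 2 + 0) % 2 ≡⟨ cong (_% 2) (+-identityʳ (b % 2)) ⟩
  b % 2 % 2       ≡⟨ m%n%n≡m%n b 2 ⟩
  b % 2           ≡⟨ +-identityʳ (b % 2) ⟨
  b % 2 + 0       ∎
  where open ≡-Reasoning

-- The lowest digits r of n and s of k contribute r + 5s + c to n + 5k + c: its low bit stays,
-- the rest is carried.
low-bit carry : ℕ → ℕ → ℕ → ℕ
low-bit c r s = (r + 5 * s + c) % 2
carry   c r s = (r + 5 * s + c) / 2

low-bit≤1 : ∀ c r s → low-bit c r s ≤ 1
low-bit≤1 c r s = ≤-pred (m%n<n (r + 5 * s + c) 2)

coeff : ℕ → ℕ → ℕ → ℕ → ℕ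
coeff c d r s = (low-bit c r s C d) * (r C s)

coeff≤1 : ∀ c {d r} s → d ≤ 1 → r ≤ 1 → s ≤ 1 → coeff c d r s ≤ 1
coeff≤1 c {r = r} s d≤1 r≤1 s≤1 = *-mono-≤ (C≤1 (low-bit≤1 c r s) d≤1) (C≤1 r≤1 s≤1)

term-digit : ∀ c d r s m k → d ≤ 1 → r ≤ 1 → s ≤ 1 →
  term c d (r + 2 * m) (s + 2 * k) ≡ coeff c d r s * term (carry c r s) s m k
term-digit c d r s m k d≤1 r≤1 s≤1 = begin
  (((r + 2 * m + 5 * (s + 2 * k) + c) C (2 * (s + 2 * k) + d)) * ((r + 2 * m) C (s + 2 * k))) % 2
    ≡⟨ cong₂ (λ a b → ((a C b) * ((r + 2 * m) C (s + 2 * k))) % 2) top bottom ⟩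
  (((x + 2 * (m + 5 * k + q)) C (d + 2 * (2 * k + s))) * ((r + 2 * m) C (s + 2 * k))) % 2
    ≡⟨ mod₂-≡ (*-cong-≡₂ (lucas₂ (m + 5 * k + q) (2 * k + s) (low-bit≤1 c r s) d≤1)
                         (lucas₂ m k r≤1 s≤1)) ⟩
  (((x C d) * ((m + 5 * k + q) C (2 * k + s))) * ((r C s) * (m C k))) % 2
    ≡⟨ cong (_% 2) (regroup (x C d) ((m + 5 * k + q) C (2 * k + s)) (r C s) (m C k)) ⟩
  (coeff c d r s * upper) % 2
    ≡⟨ mod₂-≡ (*-cong-≡₂ (≡⇒≡₂ {coeff c d r s} refl) (≡₂-%2 upper)) ⟩
  (coeff c d r s * (upper % 2)) % 2
    ≡⟨ bit*-%2 upper (coeff≤1 c s d≤1 r≤1 s≤1) ⟩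
  coeff c d r s * term q s m k ∎
  where
  open ≡-Reasoning
  u = r + 5 * s + c
  x = low-bit c r s
  q = carry c r s
  upper = ((m + 5 * k + q) C (2 * k + s)) * (m C k)

  top : r + 2 * m + 5 * (s + 2 * k) + c ≡ x + 2 * (m + 5 * k + q)
  top = begin
    r + 2 * m + 5 * (s + 2 * k) + c   ≡⟨ split r s c m k ⟩
    (r + 5 * s + c) + 2 * (m + 5 * k) ≡⟨ cong (_+ 2 * (m + 5 * k)) (m≡m%n+[m/n]*n u 2) ⟩
    x + q * 2 + 2 * (m + 5 * k)       ≡⟨ merge x q m k ⟩
    x + 2 * (m + 5 * k + q)           ∎
    where
    split : ∀ r s c m k →
            r + 2 * m + 5 * (s + 2 * k) + c ≡ (r + 5 * s + c) + 2 * (m + 5 * k)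
    split = solve-∀
    merge : ∀ x q m k → x + q * 2 + 2 * (m + 5 * k) ≡ x + 2 * (m + 5 * k + q)
    merge = solve-∀

  bottom : 2 * (s + 2 * k) + d ≡ d + 2 * (2 * k + s)
  bottom = swap s d k
    where
    swap : ∀ s d k → 2 * (s + 2 * k) + d ≡ d + 2 * (2 * k + s)
    swap = solve-∀

  regroup : ∀ a b c e → (a * b) * (c * e) ≡ (a * c) * (b * e)
  regroup = solve-∀

total-digit : ∀ c d r m → d ≤ 1 → r ≤ 1 →
  total c d (r + 2 * m) ≡
  coeff c d r 0 * total (carry c r 0) 0 m + coeff c d r 1 * total (carry c r 1) 1 m
total-digit c d r m d≤1 r≤1 = begin
  ∑< (suc n) (term c d n)
    ≡⟨ ∑<-pad (suc n) (2 * suc m) (term-vanish c d n) n<2[m+1] ⟨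
  ∑< (2 * suc m) (term c d n)
    ≡⟨ ∑<-pairs (suc m) (term c d n) ⟩
  ∑< (suc m) (λ k → term c d n (2 * k) + term c d n (1 + 2 * k))
    ≡⟨ ∑<-cong (suc m) (λ k → cong₂ _+_ (term-digit c d r 0 m k d≤1 r≤1 z≤n)
                                         (term-digit c d r 1 m k d≤1 r≤1 (s≤s z≤n))) ⟩
  ∑< (suc m) (λ k → coeff c d r 0 * term (carry c r 0) 0 m k
                  + coeff c d r 1 * term (carry c r 1) 1 m k)
    ≡⟨ ∑<-linear (suc m) (coeff c d r 0) (coeff c d r 1)
                 (term (carry c r 0) 0 m) (term (carry c r 1) 1 m) ⟩
  coeff c d r 0 * total (carry c r 0) 0 m + coeff c d r 1 * total (carry c r 1) 1 m ∎
  where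
  open ≡-Reasoning
  n = r + 2 * m
  n<2[m+1] : n < 2 * suc m
  n<2[m+1] = ≤-trans (s≤s (+-monoˡ-≤ (2 * m) r≤1)) (≤-reflexive (sym (*-suc 2 m)))

fromBits : List ℕ → ℕ
fromBits []       = 0
fromBits (r ∷ ds) = r + 2 * fromBits ds

fromBits-bits : ∀ n → fromBits (bits n) ≡ n
fromBits-bits n = fromBits-bitsFuel n n ≤-refl
  where
  fromBits-bitsFuel : ∀ f n → n ≤ f → fromBits (bitsFuel f n) ≡ n
  fromBits-bitsFuel zero    zero      _         = refl
  fromBits-bitsFuel (suc f) zero      _         = refl
  fromBits-bitsFuel (suc f) n@(suc _) (s≤s n≤f) = begin
    n % 2 + 2 * fromBits (bitsFuel f (n / 2))
      ≡⟨ cong (λ h → n % 2 + 2 * h) (fromBits-bitsFuel f (n / 2) n/2≤f) ⟩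
    n % 2 + 2 * (n / 2) ≡⟨ cong (_+_ (n % 2)) (*-comm 2 (n / 2)) ⟩
    n % 2 + n / 2 * 2   ≡⟨ m≡m%n+[m/n]*n n 2 ⟨
    n                   ∎
    where
    open ≡-Reasoning
    n/2≤f : n / 2 ≤ f
    n/2≤f = ≤-trans (≤-pred (m/n<m n 2 (s≤s (s≤s z≤n)))) n≤f

bits-binary : ∀ n → All (_≤ 1) (bits n)
bits-binary n = bitsFuel-binary n n
  where
  bitsFuel-binary : ∀ f n → All (_≤ 1) (bitsFuel f n)
  bitsFuel-binary zero    _         = []
  bitsFuel-binary (suc f) zero      = []
  bitsFuel-binary (suc f) n@(suc _) = ≤-pred (m%n<n n 2) ∷ bitsFuel-binary f (n / 2)

binary-induction : (P : ℕ → Set) → P 0 →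
                   (∀ m → P m → P (2 * m)) → (∀ m → P m → P (1 + 2 * m)) → ∀ n → P n
binary-induction P P0 P-even P-odd n =
  subst P (fromBits-bits n) (go (bits n) (bits-binary n))
  where
  go : ∀ ds → All (_≤ 1) ds → P (fromBits ds)
  go []       []                = P0
  go (0 ∷ ds) (_         ∷ bin) = P-even (fromBits ds) (go ds bin)
  go (1 ∷ ds) (_         ∷ bin) = P-odd (fromBits ds) (go ds bin)
  go (suc (suc _) ∷ _) (s≤s () ∷ _)

total₁₀≡total₀₀ : ∀ n → total 1 0 n ≡ total 0 0 n
total₁₀≡total₀₀ = binary-induction (λ n → total 1 0 n ≡ total 0 0 n) refl
  (λ m _ → trans (total-digit 1 0 0 m z≤n z≤n) (sym (total-digit 0 0 0 m z≤n z≤n)))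
  (λ m ih → trans (total-digit 1 0 1 m z≤n (s≤s z≤n))
                  (trans (cong (λ t → 1 * t + 1 * total 3 1 m) ih)
                         (sym (total-digit 0 0 1 m z≤n (s≤s z≤n)))))

-- sᶜᵈ stands for the carries (c, d) of total c d; the pair (1, 0) is merged into (0, 0)
-- by total₁₀≡total₀₀, and no other pair is reachable from (0, 0).
data State : Set where
  s₀₀ s₂₀ s₃₁ s₄₁ : State

totals : ℕ → State → ℕ
totals n s₀₀ = total 0 0 n
totals n s₂₀ = total 2 0 n
totals n s₃₁ = total 3 1 n
totals n s₄₁ = total 4 1 n

M₀ M₁ : (State → ℕ) → State → ℕ
M₀ v s₀₀ = v s₀₀
M₀ v s₂₀ = v s₀₀
M₀ v s₃₁ = v s₀₀
M₀ v s₄₁ = 0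
M₁ v s₀₀ = v s₀₀ + v s₃₁
M₁ v s₂₀ = v s₀₀ + v s₄₁
M₁ v s₃₁ = v s₄₁
M₁ v s₄₁ = v s₂₀

pick-left : ∀ x y → 1 * x + 0 * y ≡ x
pick-left = solve-∀

pick-right : ∀ x y → 0 * x + 1 * y ≡ y
pick-right = solve-∀

pick-both : ∀ x y → 1 * x + 1 * y ≡ x + y
pick-both = solve-∀

totals-even : ∀ m σ → totals (2 * m) σ ≡ M₀ (totals m) σ
totals-even m s₀₀ = trans (total-digit 0 0 0 m z≤n z≤n)
                          (pick-left (total 0 0 m) (total 2 1 m))
totals-even m s₂₀ = trans (total-digit 2 0 0 m z≤n z≤n)
                          (trans (pick-left (total 1 0 m) (total 3 1 m)) (total₁₀≡total₀₀ m))
totals-even m s₃₁ = trans (total-digit 3 1 0 m (s≤s z≤n) z≤n)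
                          (trans (pick-left (total 1 0 m) (total 4 1 m)) (total₁₀≡total₀₀ m))
totals-even m s₄₁ = total-digit 4 1 0 m (s≤s z≤n) z≤n

totals-odd : ∀ m σ → totals (1 + 2 * m) σ ≡ M₁ (totals m) σ
totals-odd m s₀₀ = trans (total-digit 0 0 1 m z≤n (s≤s z≤n))
                         (pick-both (total 0 0 m) (total 3 1 m))
totals-odd m s₂₀ = trans (total-digit 2 0 1 m z≤n (s≤s z≤n))
                         (trans (pick-both (total 1 0 m) (total 4 1 m))
                                (cong (_+ total 4 1 m) (total₁₀≡total₀₀ m)))
totals-odd m s₃₁ = trans (total-digit 3 1 1 m (s≤s z≤n) (s≤s z≤n))
                         (pick-right (total 2 0 m) (total 4 1 m))
totals-odd m s₄₁ = trans (total-digit 4 1 1 m (s≤s z≤n) (s≤s z≤n))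
                         (pick-left (total 2 0 m) (total 5 1 m))

-- Sᴺ j = T (2ʲ − 1), the value of the automaton on a run of j ones.
Sᵛ : ℕ → State → ℕ
Sᵛ zero    σ = totals 0 σ
Sᵛ (suc j) σ = M₁ (Sᵛ j) σ

Sᴺ : ℕ → ℕ
Sᴺ j = Sᵛ j s₀₀

Sᴺ-recurrence : ∀ j → Sᴺ (4 + j) + Sᴺ (1 + j) ≡ Sᴺ (3 + j) + Sᴺ (2 + j) + Sᴺ j
Sᴺ-recurrence j = cayley-hamilton (Sᵛ j s₀₀) (Sᵛ j s₂₀) (Sᵛ j s₃₁) (Sᵛ j s₄₁)
  where
  cayley-hamilton : ∀ a b c d →
    ((((a + c) + d) + b) + (a + d)) + (a + c) ≡
    (((a + c) + d) + b) + ((a + c) + d) + a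
  cayley-hamilton = solve-∀

ℤ-isolate : ∀ x₄ x₃ x₂ x₁ x₀ → x₄ + x₁ ≡ x₃ + x₂ + x₀ →
            + x₄ ≡ + x₃ ℤ.+ + x₂ ℤ.- + x₁ ℤ.+ + x₀
ℤ-isolate x₄ x₃ x₂ x₁ x₀ eq = begin
  + x₄                               ≡⟨ add-sub (+ x₄) (+ x₁) ⟩
  (+ x₄ ℤ.+ + x₁) ℤ.- + x₁           ≡⟨ cong (ℤ._- + x₁) (ℤ.pos-+ x₄ x₁) ⟨
  + (x₄ + x₁) ℤ.- + x₁               ≡⟨ cong (λ y → + y ℤ.- + x₁) eq ⟩
  + (x₃ + x₂ + x₀) ℤ.- + x₁          ≡⟨ cong (ℤ._- + x₁) pos-+₃ ⟩
  (+ x₃ ℤ.+ + x₂ ℤ.+ + x₀) ℤ.- + x₁  ≡⟨ reorder (+ x₃) (+ x₂) (+ x₁) (+ x₀) ⟩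
  + x₃ ℤ.+ + x₂ ℤ.- + x₁ ℤ.+ + x₀    ∎
  where
  open ≡-Reasoning
  pos-+₃ : + (x₃ + x₂ + x₀) ≡ + x₃ ℤ.+ + x₂ ℤ.+ + x₀
  pos-+₃ = trans (ℤ.pos-+ (x₃ + x₂) x₀) (cong (ℤ._+ + x₀) (ℤ.pos-+ x₃ x₂))
  add-sub : ∀ x y → x ≡ (x ℤ.+ y) ℤ.- y
  add-sub = ℤ-Solver.solve-∀
  reorder : ∀ a b c d → (a ℤ.+ b ℤ.+ d) ℤ.- c ≡ a ℤ.+ b ℤ.- c ℤ.+ d
  reorder = ℤ-Solver.solve-∀

S-fromℕ : ∀ j → + Sᴺ j ≡ S j
S-fromℕ 0 = refl
S-fromℕ 1 = refl
S-fromℕ 2 = refl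
S-fromℕ 3 = refl
S-fromℕ (suc (suc (suc (suc j)))) =
  trans (ℤ-isolate (Sᴺ (4 + j)) (Sᴺ (3 + j)) (Sᴺ (2 + j)) (Sᴺ (1 + j)) (Sᴺ j) (Sᴺ-recurrence j))
        (cong₂ ℤ._+_ (cong₂ ℤ._-_ (cong₂ ℤ._+_ (S-fromℕ (suc (suc (suc j))))
                                               (S-fromℕ (suc (suc j))))
                                 (S-fromℕ (suc j)))
                     (S-fromℕ j))

infixl 7 _·_

_·_ : (State → ℕ) → (State → ℕ) → ℕ
w · v = w s₀₀ * v s₀₀ + w s₂₀ * v s₂₀ + w s₃₁ * v s₃₁ + w s₄₁ * v s₄₁

·-congʳ : ∀ w {v v′} → v ≗ v′ → w · v ≡ w · v′
·-congʳ w {v} {v′} v≗v′ = cong₂ _+_ (cong₂ _+_ (cong₂ _+_ (entry s₀₀) (entry s₂₀)) (entry s₃₁)) (entry s₄₁)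
  where
  entry : ∀ σ → w σ * v σ ≡ w σ * v′ σ
  entry σ = cong (w σ *_) (v≗v′ σ)

rowM₁ : (State → ℕ) → State → ℕ
rowM₁ w s₀₀ = w s₀₀ + w s₂₀
rowM₁ w s₂₀ = w s₄₁
rowM₁ w s₃₁ = w s₀₀
rowM₁ w s₄₁ = w s₂₀ + w s₃₁

rowM₁-· : ∀ w v → rowM₁ w · v ≡ w · M₁ v
rowM₁-· w v = transpose (w s₀₀) (w s₂₀) (w s₃₁) (w s₄₁) (v s₀₀) (v s₂₀) (v s₃₁) (v s₄₁)
  where
  transpose : ∀ w₀ w₂ w₃ w₄ v₀ v₂ v₃ v₄ →
    (w₀ + w₂) * v₀ + w₄ * v₂ + w₀ * v₃ + (w₂ + w₃) * v₄ ≡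
    w₀ * (v₀ + v₃) + w₂ * (v₀ + v₄) + w₃ * v₄ + w₄ * v₂
  transpose = solve-∀

·-M₀ : ∀ w v → w · M₀ v ≡ (w · totals 0) * v s₀₀
·-M₀ w v = factor (w s₀₀) (w s₂₀) (w s₃₁) (w s₄₁) (v s₀₀)
  where
  factor : ∀ w₀ w₂ w₃ w₄ v₀ →
    w₀ * v₀ + w₂ * v₀ + w₃ * v₀ + w₄ * 0 ≡ (w₀ * 1 + w₂ * 1 + w₃ * 1 + w₄ * 0) * v₀
  factor = solve-∀

ρ : ℕ → State → ℕ
ρ zero    s₀₀ = 1
ρ zero    _   = 0
ρ (suc j) σ   = rowM₁ (ρ j) σ

ρ₀-· : ∀ v → ρ 0 · v ≡ v s₀₀
ρ₀-· v = unit (v s₀₀) (v s₂₀) (v s₃₁) (v s₄₁)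
  where
  unit : ∀ v₀ v₂ v₃ v₄ → 1 * v₀ + 0 * v₂ + 0 * v₃ + 0 * v₄ ≡ v₀
  unit = solve-∀

ρ-·-Sᵛ : ∀ j i → ρ j · Sᵛ i ≡ Sᴺ (j + i)
ρ-·-Sᵛ zero    i = ρ₀-· (Sᵛ i)
ρ-·-Sᵛ (suc j) i = begin
  rowM₁ (ρ j) · Sᵛ i   ≡⟨ rowM₁-· (ρ j) (Sᵛ i) ⟩
  ρ j · Sᵛ (suc i)     ≡⟨ ρ-·-Sᵛ j (suc i) ⟩
  Sᴺ (j + suc i)       ≡⟨ cong Sᴺ (+-suc j i) ⟩
  Sᴺ (suc j + i)       ∎
  where open ≡-Reasoning

ρ-·-totals₀ : ∀ j → ρ j · totals 0 ≡ Sᴺ j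
ρ-·-totals₀ j = trans (ρ-·-Sᵛ j 0) (cong Sᴺ (+-identityʳ j))

∏S : List ℕ → ℤ.ℤ
∏S ls = foldr ℤ._*_ (+ 1) (map S ls)

runsAux-1 : ∀ j ds → runsAux j (1 ∷ ds) ≡ runsAux (suc j) ds
runsAux-1 zero    ds = refl
runsAux-1 (suc j) ds = refl

∏S-runsAux-0 : ∀ j ds → ∏S (runsAux j (0 ∷ ds)) ≡ S j ℤ.* ∏S (runsAux 0 ds)
∏S-runsAux-0 zero    ds = sym (ℤ.*-identityˡ (∏S (runsAux 0 ds)))
∏S-runsAux-0 (suc j) ds = refl

∏S-runsAux : ∀ ds → All (_≤ 1) ds → ∀ j →
             ∏S (runsAux j ds) ≡ + (ρ j · totals (fromBits ds))
∏S-runsAux []       []      zero    = refl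
∏S-runsAux []       []      (suc j) = begin
  S (suc j) ℤ.* + 1                   ≡⟨ ℤ.*-identityʳ (S (suc j)) ⟩
  S (suc j)                           ≡⟨ S-fromℕ (suc j) ⟨
  + Sᴺ (suc j)                        ≡⟨ cong +_ (ρ-·-totals₀ (suc j)) ⟨
  + (ρ (suc j) · totals 0)            ∎
  where open ≡-Reasoning
∏S-runsAux (0 ∷ ds) (_ ∷ bin) j = begin
  ∏S (runsAux j (0 ∷ ds))             ≡⟨ ∏S-runsAux-0 j ds ⟩
  S j ℤ.* ∏S (runsAux 0 ds)           ≡⟨ cong₂ ℤ._*_ (sym (S-fromℕ j)) (∏S-runsAux ds bin 0) ⟩
  + Sᴺ j ℤ.* + (ρ 0 · totals m)       ≡⟨ ℤ.pos-* (Sᴺ j) (ρ 0 · totals m) ⟨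
  + (Sᴺ j * (ρ 0 · totals m))         ≡⟨ cong +_ (cong₂ _*_ (sym (ρ-·-totals₀ j))
                                                            (ρ₀-· (totals m))) ⟩
  + ((ρ j · totals 0) * totals m s₀₀) ≡⟨ cong +_ (·-M₀ (ρ j) (totals m)) ⟨
  + (ρ j · M₀ (totals m))             ≡⟨ cong +_ (·-congʳ (ρ j) (totals-even m)) ⟨
  + (ρ j · totals (2 * m))            ∎
  where
  open ≡-Reasoning
  m = fromBits ds
∏S-runsAux (1 ∷ ds) (_ ∷ bin) j = begin
  ∏S (runsAux j (1 ∷ ds))             ≡⟨ cong ∏S (runsAux-1 j ds) ⟩
  ∏S (runsAux (suc j) ds)             ≡⟨ ∏S-runsAux ds bin (suc j) ⟩
  + (rowM₁ (ρ j) · totals m)          ≡⟨ cong +_ (rowM₁-· (ρ j) (totals m)) ⟩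
  + (ρ j · M₁ (totals m))             ≡⟨ cong +_ (·-congʳ (ρ j) (totals-odd m)) ⟨
  + (ρ j · totals (1 + 2 * m))        ∎
  where
  open ≡-Reasoning
  m = fromBits ds
∏S-runsAux (suc (suc _) ∷ _) (s≤s () ∷ _) _

theorem11 : (n : ℕ) → + (T n) ≡ runLengthTransform S n
theorem11 n = begin
  + T n                                 ≡⟨ cong +_ (T≡total n) ⟩
  + total 0 0 n                         ≡⟨ cong (λ m → + total 0 0 m) (fromBits-bits n) ⟨
  + total 0 0 (fromBits (bits n))       ≡⟨ cong +_ (ρ₀-· (totals (fromBits (bits n)))) ⟨
  + (ρ 0 · totals (fromBits (bits n)))  ≡⟨ ∏S-runsAux (bits n) (bits-binary n) 0 ⟨
  ∏S (runsAux 0 (bits n))               ∎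
  where open ≡-Reasoning
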